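{- For every prime $p\ge5$ and all integers $a,m\ge0$, \[ [q^{ap}]\,C(q)H(q^p)^m\equiv[q^a]\,C(q)H(q)^m\pmod{p^4}. \]
   Context: $\chi_3(n)=\left(\frac{n}{3}\right)$; $C(q)=1+\sum_{n\ge1}c_nq^n$, $c_n=3\sum_{d\mid n}\chi_3(d)d^4$; $t(q)=q\prod_{n\ge1}(1-q^{3n})^{12}(1-q^n)^{ -12}$, $H(q)=q/t(q)\in1+q\mathbf{Z}[[q]]$. -}

module Defs where

open import Data.Nat as ℕ using (ℕ; zero; suc; _%_; _/_)
open import Data.Nat.Divisibility using (_∣?_)
open import Data.Integer as ℤ using (ℤ; +_; -_; _+_; _*_; _-_; _^_)
open import Data.List using (List; []; _∷_; map; upTo; zipWith; filter; foldr)
open import Relation.Nullary.Decidable using (does)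
open import Data.Bool using (if_then_else_)

-- Formal power series with integer coefficients: f n = [q^n] f.
Series : Set
Series = ℕ → ℤ

sum : List ℤ → ℤ
sum = foldr _+_ (+ 0)

Σ< : ℕ → (ℕ → ℤ) → ℤ
Σ< n f = sum (map f (upTo n))

one : Series
one zero = + 1
one (suc _) = + 0

_⊛_ : Series → Series → Series
(f ⊛ g) n = Σ< (suc n) (λ k → f k * g (n ℕ.∸ k))

infixl 7 _⊛_

pow : Series → ℕ → Series
pow f zero = one
pow f (suc m) = f ⊛ pow f m

-- 1 - q^k  (k ≥ 1)
oneMinusQ : ℕ → Series
oneMinusQ k zero = + 1
oneMinusQ k (suc n) = if does (suc n ℕ.≟ k) then - (+ 1) else + 0

-- (1 - q^k)^{-1} = Σ_{j ≥ 0} q^{kj}  (k ≥ 1)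
geomQ : ℕ → Series
geomQ k n = if does (k ∣? n) then + 1 else + 0

prodTo : ℕ → (ℕ → Series) → Series
prodTo zero F = one
prodTo (suc N) F = prodTo N F ⊛ F (suc N)

-- infinite product ∏_{n≥1} F n, for factors with F n ≡ 1 mod q^n:
-- the coefficient of q^N only depends on the factors n ≤ N.
prodInf : (ℕ → Series) → Series
prodInf F N = prodTo N F N

-- substitution q ↦ q^p (only used for p ≥ 1; p = 0 is an unused junk case)
substQ : ℕ → Series → Series
substQ zero f n = + 0
substQ (suc p) f n = if does (suc p ∣? n) then f (n / suc p) else + 0

-- reciprocal of a series with constant term 1:
-- g 0 = 1, g n = - Σ_{k=1}^{n} f k * g (n - k).
-- invList f N = [g N, g (N-1), ..., g 0]
invList : Series → ℕ → List ℤ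
invList f zero = + 1 ∷ []
invList f (suc N) =
  - sum (zipWith (λ j g → f (suc j) * g) (upTo (suc N)) (invList f N))
  ∷ invList f N

inv1 : Series → Series
inv1 f n with invList f n
... | [] = + 0
... | x ∷ _ = x

divQ : Series → Series
divQ f n = f (suc n)

χ₃ : ℕ → ℤ
χ₃ n with n % 3
... | 1 = + 1
... | 2 = - (+ 1)
... | _ = + 0

cCoef : ℕ → ℤ
cCoef n = + 3 * sum (map (λ d → χ₃ d * ((+ d) ^ 4))
                         (filter (λ d → d ∣? n) (map suc (upTo n))))

C : Series
C zero = + 1
C (suc n) = cCoef (suc n)

-- t(q) = q ∏_{n≥1} (1-q^{3n})^{12} (1-q^n)^{-12}
t : Series
t zero = + 0
t (suc N) = prodInf (λ n → pow (oneMinusQ (3 ℕ.* n)) 12 ⊛ pow (geomQ n) 12) N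

-- H(q) = q / t(q)
H : Series
H = inv1 (divQ t)

{-# OPTIONS --safe #-}
module Submission where

-- Substitution q ↦ q^p is multiplicative, so H(q^p)^m = K(q^p) with K = H^m, and the
-- coefficient of q^{ap} in C(q) K(q^p) is Σ_{j ≤ a} c_{(a-j)p} k_j, while that of q^a in
-- C(q) K(q) is Σ_{j ≤ a} c_{a-j} k_j. So it suffices that c_{np} ≡ c_n (mod p^4): a divisor
-- d of np not dividing n is a multiple of p, so its term χ₃(d) d^4 vanishes mod p^4.

open import Defs
open import Data.Nat
  using (ℕ; zero; suc; _+_; _*_; _^_; _∸_; _≤_; _<_; s≤s; z<s; s<s; NonZero; >-nonZero)
open import Data.Nat.Properties
  using (+-comm; +-assoc; +-identityʳ; *-comm; *-distribʳ-∸; m∸[m∸n]≡n; m+[n∸m]≡n; ≤-pred; m≤m+n; m≤m*n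
        ; <⇒≱)
import Data.Nat.Divisibility as ℕ
open import Data.Nat.Divisibility
  using (_∤_; divides; n∣m*n; ∣m⇒∣m*n; ∣m+n∣m⇒∣n; ∣m∣n⇒∣m+n; *-pres-∣; ∣⇒≤; >⇒∤)
open import Data.Nat.DivMod using (m*n/n≡m)
open import Data.Nat.Primality using (Prime; ¬prime[0]; prime⇒irreducible; prime⇒nonZero)
open import Data.Nat.Coprimality using (Coprime; coprime-divisor)
open import Data.Integer as ℤ using (ℤ; +_; _-_)
import Data.Integer.Properties as ℤₚ
import Data.Integer.Divisibility.Signed as ℤ
open import Data.Integer.Divisibility.Signed using (∣ᵤ⇒∣; ∣⇒∣ᵤ)
open import Data.Integer.Divisibility using (_∣_)
open import Data.Integer.Tactic.RingSolver using (solve-∀)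
open import Data.List using ([]; _∷_; map; filter; upTo; applyUpTo)
open import Data.List.Properties using (map-upTo; map-applyUpTo; map-∘)
open import Data.Bool using (true; false; if_then_else_)
open import Data.Sum using (inj₁; inj₂)
open import Data.Product using (_,_)
open import Data.Empty using (⊥-elim)
open import Function using (_∘_)
open import Relation.Nullary using (yes; no)
open import Relation.Nullary.Decidable using (does; dec-true; dec-false)
open import Relation.Unary using (Pred; Decidable)
open import Relation.Binary.PropositionalEquality

open ≡-Reasoning

Σ<-suc : ∀ n f → Σ< (suc n) f ≡ f 0 ℤ.+ Σ< n (f ∘ suc)
Σ<-suc n f = cong (ℤ._+_ (f 0)) (begin
  sum (map f (applyUpTo suc n))  ≡⟨ cong sum (map-applyUpTo suc f n) ⟩
  sum (applyUpTo (f ∘ suc) n)    ≡⟨ cong sum (map-upTo (f ∘ suc) n) ⟨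
  Σ< n (f ∘ suc)                 ∎)

Σ<-cong : ∀ n {f g : ℕ → ℤ} → (∀ k → k < n → f k ≡ g k) → Σ< n f ≡ Σ< n g
Σ<-cong zero    _   = refl
Σ<-cong (suc n) {f} {g} f≡g = begin
  Σ< (suc n) f            ≡⟨ Σ<-suc n f ⟩
  f 0 ℤ.+ Σ< n (f ∘ suc)  ≡⟨ cong₂ ℤ._+_ (f≡g 0 z<s) (Σ<-cong n (λ k → f≡g (suc k) ∘ s<s)) ⟩
  g 0 ℤ.+ Σ< n (g ∘ suc)  ≡⟨ Σ<-suc n g ⟨
  Σ< (suc n) g            ∎

Σ<-zero : ∀ n {f : ℕ → ℤ} → (∀ k → k < n → f k ≡ + 0) → Σ< n f ≡ + 0
Σ<-zero zero    _  = refl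
Σ<-zero (suc n) {f} f≡0 = begin
  Σ< (suc n) f            ≡⟨ Σ<-suc n f ⟩
  f 0 ℤ.+ Σ< n (f ∘ suc)  ≡⟨ cong₂ ℤ._+_ (f≡0 0 z<s) (Σ<-zero n (λ k → f≡0 (suc k) ∘ s<s)) ⟩
  + 0                     ∎

Σ<-+ : ∀ m n f → Σ< (m + n) f ≡ Σ< m f ℤ.+ Σ< n (λ k → f (m + k))
Σ<-+ zero    n f = sym (ℤₚ.+-identityˡ (Σ< n f))
Σ<-+ (suc m) n f = begin
  Σ< (suc (m + n)) f
    ≡⟨ Σ<-suc (m + n) f ⟩
  f 0 ℤ.+ Σ< (m + n) (f ∘ suc)
    ≡⟨ cong (ℤ._+_ (f 0)) (Σ<-+ m n (f ∘ suc)) ⟩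
  f 0 ℤ.+ (Σ< m (f ∘ suc) ℤ.+ Σ< n (λ k → f (suc m + k)))
    ≡⟨ ℤₚ.+-assoc (f 0) _ _ ⟨
  (f 0 ℤ.+ Σ< m (f ∘ suc)) ℤ.+ Σ< n (λ k → f (suc m + k))
    ≡⟨ cong (ℤ._+ Σ< n (λ k → f (suc m + k))) (Σ<-suc m f) ⟨
  Σ< (suc m) f ℤ.+ Σ< n (λ k → f (suc m + k))
    ∎

Σ<-last : ∀ n f → Σ< (suc n) f ≡ Σ< n f ℤ.+ f n
Σ<-last n f = begin
  Σ< (suc n) f                    ≡⟨ cong (λ m → Σ< m f) (+-comm 1 n) ⟩
  Σ< (n + 1) f                    ≡⟨ Σ<-+ n 1 f ⟩
  Σ< n f ℤ.+ (f (n + 0) ℤ.+ + 0)  ≡⟨ cong (ℤ._+_ (Σ< n f)) (ℤₚ.+-identityʳ (f (n + 0))) ⟩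
  Σ< n f ℤ.+ f (n + 0)            ≡⟨ cong (ℤ._+_ (Σ< n f) ∘ f) (+-identityʳ n) ⟩
  Σ< n f ℤ.+ f n                  ∎

Σ<-reverse : ∀ n f → Σ< n f ≡ Σ< n (λ k → f (n ∸ suc k))
Σ<-reverse zero    f = refl
Σ<-reverse (suc n) f = begin
  Σ< (suc n) f                        ≡⟨ Σ<-last n f ⟩
  Σ< n f ℤ.+ f n                      ≡⟨ cong (ℤ._+ f n) (Σ<-reverse n f) ⟩
  Σ< n (λ k → f (n ∸ suc k)) ℤ.+ f n  ≡⟨ ℤₚ.+-comm _ (f n) ⟩
  f n ℤ.+ Σ< n (λ k → f (n ∸ suc k))  ≡⟨ Σ<-suc n (λ k → f (n ∸ k)) ⟨
  Σ< (suc n) (λ k → f (n ∸ k))        ∎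

Σ<-blocks : ∀ a p f → Σ< (a * p) f ≡ Σ< a (λ j → Σ< p (λ s → f (j * p + s)))
Σ<-blocks zero    p f = refl
Σ<-blocks (suc a) p f = begin
  Σ< (p + a * p) f
    ≡⟨ Σ<-+ p (a * p) f ⟩
  Σ< p f ℤ.+ Σ< (a * p) (λ k → f (p + k))
    ≡⟨ cong (ℤ._+_ (Σ< p f)) (Σ<-blocks a p _) ⟩
  Σ< p f ℤ.+ Σ< a (λ j → Σ< p (λ s → f (p + (j * p + s))))
    ≡⟨ cong (ℤ._+_ (Σ< p f)) (Σ<-cong a reassoc) ⟩
  Σ< p f ℤ.+ Σ< a (λ j → Σ< p (λ s → f (suc j * p + s)))
    ≡⟨ Σ<-suc a (λ j → Σ< p (λ s → f (j * p + s))) ⟨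
  Σ< (suc a) (λ j → Σ< p (λ s → f (j * p + s)))
    ∎
  where
  reassoc : ∀ j → j < a → Σ< p (λ s → f (p + (j * p + s))) ≡ Σ< p (λ s → f (suc j * p + s))
  reassoc j _ = Σ<-cong p (λ s _ → cong f (sym (+-assoc p (j * p) s)))

n∤m*n+o : ∀ {n} m {o} → 0 < o → o < n → n ∤ m * n + o
n∤m*n+o m 0<o o<n n∣m*n+o = <⇒≱ o<n (∣⇒≤ {{>-nonZero 0<o}} (∣m+n∣m⇒∣n n∣m*n+o (n∣m*n m)))

Σ<-multiples : ∀ a p .{{_ : NonZero p}} f → (∀ k → p ∤ k → f k ≡ + 0) →
               Σ< (a * p) f ≡ Σ< a (λ j → f (j * p))
Σ<-multiples a (suc p) f vanishes = begin
  Σ< (a * suc p) f                                  ≡⟨ Σ<-blocks a (suc p) f ⟩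
  Σ< a (λ j → Σ< (suc p) (λ s → f (j * suc p + s))) ≡⟨ Σ<-cong a (λ j _ → block j) ⟩
  Σ< a (λ j → f (j * suc p))                        ∎
  where
  block : ∀ j → Σ< (suc p) (λ s → f (j * suc p + s)) ≡ f (j * suc p)
  block j = begin
    Σ< (suc p) (λ s → f (j * suc p + s))
      ≡⟨ Σ<-suc p (λ s → f (j * suc p + s)) ⟩
    f (j * suc p + 0) ℤ.+ Σ< p (λ s → f (j * suc p + suc s))
      ≡⟨ cong₂ ℤ._+_ (cong f (+-identityʳ _)) (Σ<-zero p off) ⟩
    f (j * suc p) ℤ.+ + 0
      ≡⟨ ℤₚ.+-identityʳ _ ⟩
    f (j * suc p)
      ∎
    where
    off : ∀ s → s < p → f (j * suc p + suc s) ≡ + 0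
    off s s<p = vanishes _ (n∤m*n+o j z<s (s<s s<p))

infix 4 _≡_mod_

-- A record rather than a definition, so that x, y and d are inferable from the type.
record _≡_mod_ (x y d : ℤ) : Set where
  constructor divides-difference
  field difference-divisible : d ℤ.∣ x - y

open _≡_mod_

mod-refl : ∀ {d} x → x ≡ x mod d
mod-refl {d} x =
  divides-difference (subst (d ℤ.∣_) (sym (ℤₚ.+-inverseʳ x)) (∣ᵤ⇒∣ (ℕ.divides 0 refl)))

+-cong-mod : ∀ {d x y u v} → x ≡ y mod d → u ≡ v mod d → x ℤ.+ u ≡ y ℤ.+ v mod d
+-cong-mod {d} {x} {y} {u} {v} (divides-difference d∣x-y) (divides-difference d∣u-v) =
  divides-difference (subst (d ℤ.∣_) (sym (rearrange x y u v)) (ℤ.∣m∣n⇒∣m+n d∣x-y d∣u-v))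
  where
  rearrange : ∀ x y u v → (x ℤ.+ u) - (y ℤ.+ v) ≡ (x - y) ℤ.+ (u - v)
  rearrange = solve-∀

*-congˡ-mod : ∀ {d x y} z → x ≡ y mod d → z ℤ.* x ≡ z ℤ.* y mod d
*-congˡ-mod {d} {x} {y} z (divides-difference d∣x-y) =
  divides-difference (subst (d ℤ.∣_) (sym (factor z x y)) (ℤ.∣n⇒∣m*n z d∣x-y))
  where
  factor : ∀ z x y → z ℤ.* x - z ℤ.* y ≡ z ℤ.* (x - y)
  factor = solve-∀

*-congʳ-mod : ∀ {d x y} z → x ≡ y mod d → x ℤ.* z ≡ y ℤ.* z mod d
*-congʳ-mod {d} {x} {y} z (divides-difference d∣x-y) =
  divides-difference (subst (d ℤ.∣_) (sym (factor x y z)) (ℤ.∣m⇒∣m*n z d∣x-y))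
  where
  factor : ∀ x y z → x ℤ.* z - y ℤ.* z ≡ (x - y) ℤ.* z
  factor = solve-∀

Σ<-cong-mod : ∀ n {d} {f g : ℕ → ℤ} → (∀ k → k < n → f k ≡ g k mod d) →
              Σ< n f ≡ Σ< n g mod d
Σ<-cong-mod zero    _ = mod-refl (+ 0)
Σ<-cong-mod (suc n) {d} {f} {g} f≡g =
  subst₂ (λ x y → x ≡ y mod d) (sym (Σ<-suc n f)) (sym (Σ<-suc n g))
    (+-cong-mod (f≡g 0 z<s) (Σ<-cong-mod n (λ k → f≡g (suc k) ∘ s<s)))

⊛-congʳ : ∀ f {g h : Series} → (∀ k → g k ≡ h k) → ∀ n → (f ⊛ g) n ≡ (f ⊛ h) n
⊛-congʳ f g≡h n = Σ<-cong (suc n) (λ k _ → cong (ℤ._*_ (f k)) (g≡h (n ∸ k)))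

⊛-reversed : ∀ f g n → (f ⊛ g) n ≡ Σ< (suc n) (λ j → f (n ∸ j) ℤ.* g j)
⊛-reversed f g n = begin
  (f ⊛ g) n                                          ≡⟨ Σ<-reverse (suc n) (λ k → f k ℤ.* g (n ∸ k)) ⟩
  Σ< (suc n) (λ j → f (n ∸ j) ℤ.* g (n ∸ (n ∸ j)))   ≡⟨ Σ<-cong (suc n) involution ⟩
  Σ< (suc n) (λ j → f (n ∸ j) ℤ.* g j)               ∎
  where
  involution : ∀ j → j < suc n → f (n ∸ j) ℤ.* g (n ∸ (n ∸ j)) ≡ f (n ∸ j) ℤ.* g j
  involution j j<1+n = cong (λ i → f (n ∸ j) ℤ.* g i) (m∸[m∸n]≡n (≤-pred j<1+n))

substQ-∤ : ∀ p f {n} → p ∤ n → substQ p f n ≡ + 0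
substQ-∤ zero    f     p∤n = refl
substQ-∤ (suc p) f {n} p∤n rewrite dec-false (suc p ℕ.∣? n) p∤n = refl

substQ-* : ∀ p .{{_ : NonZero p}} f i → substQ p f (i * p) ≡ f i
substQ-* (suc p) f i rewrite dec-true (suc p ℕ.∣? i * suc p) (n∣m*n i) = cong f (m*n/n≡m i (suc p))

⊛-substQ-* : ∀ p .{{_ : NonZero p}} A B a →
             (A ⊛ substQ p B) (a * p) ≡ Σ< (suc a) (λ j → A ((a ∸ j) * p) ℤ.* B j)
⊛-substQ-* p A B a = begin
  (A ⊛ substQ p B) (a * p)                     ≡⟨ ⊛-reversed A (substQ p B) (a * p) ⟩
  Σ< (suc (a * p)) h                           ≡⟨ Σ<-last (a * p) h ⟩
  Σ< (a * p) h ℤ.+ h (a * p)                   ≡⟨ cong (ℤ._+ h (a * p)) (Σ<-multiples a p h h-vanishes) ⟩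
  Σ< a (λ j → h (j * p)) ℤ.+ h (a * p)         ≡⟨ Σ<-last a (λ j → h (j * p)) ⟨
  Σ< (suc a) (λ j → h (j * p))                 ≡⟨ Σ<-cong (suc a) term ⟩
  Σ< (suc a) (λ j → A ((a ∸ j) * p) ℤ.* B j)   ∎
  where
  h : ℕ → ℤ
  h k = A (a * p ∸ k) ℤ.* substQ p B k
  h-vanishes : ∀ k → p ∤ k → h k ≡ + 0
  h-vanishes k p∤k =
    trans (cong (ℤ._*_ (A (a * p ∸ k))) (substQ-∤ p B p∤k)) (ℤₚ.*-zeroʳ (A (a * p ∸ k)))
  term : ∀ j → j < suc a → h (j * p) ≡ A ((a ∸ j) * p) ℤ.* B j
  term j _ = cong₂ ℤ._*_ (cong A (sym (*-distribʳ-∸ p a j))) (substQ-* p B j)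

substQ⊛substQ-∤ : ∀ p f g {n} → p ∤ n → (substQ p f ⊛ substQ p g) n ≡ + 0
substQ⊛substQ-∤ p f g {n} p∤n = Σ<-zero (suc n) term
  where
  term : ∀ k → k < suc n → substQ p f k ℤ.* substQ p g (n ∸ k) ≡ + 0
  term k k<1+n with p ℕ.∣? k | p ℕ.∣? (n ∸ k)
  ... | no p∤k  | _ =
    trans (cong (ℤ._* substQ p g (n ∸ k)) (substQ-∤ p f p∤k)) (ℤₚ.*-zeroˡ (substQ p g (n ∸ k)))
  ... | yes _   | no p∤n-k =
    trans (cong (ℤ._*_ (substQ p f k)) (substQ-∤ p g p∤n-k)) (ℤₚ.*-zeroʳ (substQ p f k))
  ... | yes p∣k | yes p∣n-k =
    ⊥-elim (p∤n (subst (p ℕ.∣_) (m+[n∸m]≡n (≤-pred k<1+n)) (∣m∣n⇒∣m+n p∣k p∣n-k)))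

substQ-⊛ : ∀ p .{{_ : NonZero p}} f g n → substQ p (f ⊛ g) n ≡ (substQ p f ⊛ substQ p g) n
substQ-⊛ p f g n with p ℕ.∣? n
... | no p∤n = trans (substQ-∤ p (f ⊛ g) p∤n) (sym (substQ⊛substQ-∤ p f g p∤n))
... | yes (divides i refl) = begin
  substQ p (f ⊛ g) (i * p)
    ≡⟨ substQ-* p (f ⊛ g) i ⟩
  (f ⊛ g) i
    ≡⟨ ⊛-reversed f g i ⟩
  Σ< (suc i) (λ j → f (i ∸ j) ℤ.* g j)
    ≡⟨ Σ<-cong (suc i) (λ j _ → cong (ℤ._* g j) (substQ-* p f (i ∸ j))) ⟨
  Σ< (suc i) (λ j → substQ p f ((i ∸ j) * p) ℤ.* g j)
    ≡⟨ ⊛-substQ-* p (substQ p f) g i ⟨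
  (substQ p f ⊛ substQ p g) (i * p)
    ∎

substQ-one : ∀ p .{{_ : NonZero p}} n → substQ p one n ≡ one n
substQ-one p zero = substQ-* p one 0
substQ-one p (suc n) with p ℕ.∣? suc n
... | no p∤n                   = substQ-∤ p one p∤n
... | yes (divides (suc i) eq) = trans (cong (substQ p one) eq) (substQ-* p one (suc i))

pow-substQ : ∀ p .{{_ : NonZero p}} f m n → pow (substQ p f) m n ≡ substQ p (pow f m) n
pow-substQ p f zero    n = sym (substQ-one p n)
pow-substQ p f (suc m) n = begin
  (substQ p f ⊛ pow (substQ p f) m) n    ≡⟨ ⊛-congʳ (substQ p f) (pow-substQ p f m) n ⟩
  (substQ p f ⊛ substQ p (pow f m)) n    ≡⟨ substQ-⊛ p f (pow f m) n ⟨
  substQ p (f ⊛ pow f m) n               ∎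

⊛-substQ-mod : ∀ p .{{_ : NonZero p}} {d A} → (∀ n → A (n * p) ≡ A n mod d) →
               ∀ B a → (A ⊛ substQ p B) (a * p) ≡ (A ⊛ B) a mod d
⊛-substQ-mod p {d} {A} A-mod B a =
  subst₂ (λ x y → x ≡ y mod d) (sym (⊛-substQ-* p A B a)) (sym (⊛-reversed A B a))
    (Σ<-cong-mod (suc a) (λ j _ → *-congʳ-mod (B j) (A-mod (a ∸ j))))

sum-map-filter : ∀ {a ℓ} {A : Set a} {P : Pred A ℓ} (P? : Decidable P) (w : A → ℤ) xs →
                 sum (map w (filter P? xs)) ≡ sum (map (λ x → if does (P? x) then w x else + 0) xs)
sum-map-filter P? w []       = refl
sum-map-filter P? w (x ∷ xs) with does (P? x)
... | true  = cong (ℤ._+_ (w x)) (sum-map-filter P? w xs)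
... | false = trans (sum-map-filter P? w xs) (sym (ℤₚ.+-identityˡ _))

divisorTerm : (ℕ → ℤ) → ℕ → ℕ → ℤ
divisorTerm w n d = if does (d ℕ.∣? n) then w d else + 0

divisorSum : (ℕ → ℤ) → ℕ → ℕ → ℤ
divisorSum w M n = Σ< M (λ k → divisorTerm w n (suc k))

divisorSum-extend : ∀ w {n M} .{{_ : NonZero n}} → n ≤ M → divisorSum w M n ≡ divisorSum w n n
divisorSum-extend w {n} {M} n≤M = begin
  divisorSum w M n
    ≡⟨ cong (λ L → divisorSum w L n) (m+[n∸m]≡n n≤M) ⟨
  divisorSum w (n + (M ∸ n)) n
    ≡⟨ Σ<-+ n (M ∸ n) _ ⟩
  divisorSum w n n ℤ.+ Σ< (M ∸ n) (λ k → divisorTerm w n (suc (n + k)))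
    ≡⟨ cong (ℤ._+_ (divisorSum w n n)) (Σ<-zero (M ∸ n) too-big) ⟩
  divisorSum w n n ℤ.+ + 0
    ≡⟨ ℤₚ.+-identityʳ _ ⟩
  divisorSum w n n
    ∎
  where
  too-big : ∀ k → k < M ∸ n → divisorTerm w n (suc (n + k)) ≡ + 0
  too-big k _ rewrite dec-false (suc (n + k) ℕ.∣? n) (>⇒∤ (s≤s (m≤m+n n k))) = refl

∣m*p∧∤m⇒p∣ : ∀ {p m d} → Prime p → d ℕ.∣ m * p → d ∤ m → p ℕ.∣ d
∣m*p∧∤m⇒p∣ {p} {m} {d} p-prime d∣m*p d∤m with p ℕ.∣? d
... | yes p∣d = p∣d
... | no  p∤d = ⊥-elim (d∤m (coprime-divisor d⊥p (subst (d ℕ.∣_) (*-comm m p) d∣m*p)))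
  where
  d⊥p : Coprime d p
  d⊥p (i∣d , i∣p) with prime⇒irreducible p-prime i∣p
  ... | inj₁ i≡1 = i≡1
  ... | inj₂ refl = ⊥-elim (p∤d i∣d)

divisorTerm-*-prime : ∀ {p} → Prime p → ∀ {d w} → (∀ k → p ℕ.∣ k → d ℤ.∣ w k) →
                      ∀ n k → divisorTerm w (n * p) k ≡ divisorTerm w n k mod d
divisorTerm-*-prime {p} p-prime {d} {w} p∣⇒d∣w n k with k ℕ.∣? n * p | k ℕ.∣? n
... | yes _     | yes _   = mod-refl (w k)
... | yes k∣n*p | no  k∤n = divides-difference
  (subst (d ℤ.∣_) (sym (ℤₚ.+-identityʳ (w k))) (p∣⇒d∣w k (∣m*p∧∤m⇒p∣ p-prime k∣n*p k∤n)))
... | no  k∤n*p | yes k∣n = ⊥-elim (k∤n*p (∣m⇒∣m*n p k∣n))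
... | no  _     | no  _   = mod-refl (+ 0)

divisorSum-*-prime : ∀ {p} → Prime p → ∀ {d w} → (∀ k → p ℕ.∣ k → d ℤ.∣ w k) →
                     ∀ n .{{_ : NonZero n}} → divisorSum w (n * p) (n * p) ≡ divisorSum w n n mod d
divisorSum-*-prime {p} p-prime {d} {w} p∣⇒d∣w n =
  subst (λ x → divisorSum w (n * p) (n * p) ≡ x mod d) (divisorSum-extend w (m≤m*n n p))
    (Σ<-cong-mod (n * p) (λ k _ → divisorTerm-*-prime p-prime p∣⇒d∣w n (suc k)))
  where
  instance
    p≢0 : NonZero p
    p≢0 = prime⇒nonZero p-prime

weight : ℕ → ℤ
weight d = χ₃ d ℤ.* (+ d) ℤ.^ 4

cCoef-divisorSum : ∀ n → cCoef n ≡ + 3 ℤ.* divisorSum weight n n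
cCoef-divisorSum n = cong (ℤ._*_ (+ 3)) (begin
  sum (map weight (filter (ℕ._∣? n) (map suc (upTo n))))
    ≡⟨ sum-map-filter (ℕ._∣? n) weight (map suc (upTo n)) ⟩
  sum (map (divisorTerm weight n) (map suc (upTo n)))
    ≡⟨ cong sum (map-∘ (upTo n)) ⟨
  divisorSum weight n n
    ∎)

^-monoˡ-∣ : ∀ k {m n} → m ℕ.∣ n → m ^ k ℕ.∣ n ^ k
^-monoˡ-∣ zero    _   = ℕ.∣-refl
^-monoˡ-∣ (suc k) m∣n = *-pres-∣ m∣n (^-monoˡ-∣ k m∣n)

pos-^ : ∀ m k → + (m ^ k) ≡ (+ m) ℤ.^ k
pos-^ m zero    = refl
pos-^ m (suc k) = trans (ℤₚ.pos-* m (m ^ k)) (cong (ℤ._*_ (+ m)) (pos-^ m k))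

weight-divisible : ∀ {p} d → p ℕ.∣ d → + (p ^ 4) ℤ.∣ weight d
weight-divisible {p} d p∣d =
  ℤ.∣n⇒∣m*n (χ₃ d) (∣ᵤ⇒∣ (subst (+ (p ^ 4) ∣_) (pos-^ d 4) (^-monoˡ-∣ 4 p∣d)))

C[n*p]≡C[n] : ∀ {p} → Prime p → ∀ n → C (n * p) ≡ C n mod + (p ^ 4)
C[n*p]≡C[n] {zero}  p-prime _       = ⊥-elim (¬prime[0] p-prime)
C[n*p]≡C[n] {suc p} p-prime zero    = mod-refl (+ 1)
C[n*p]≡C[n] {suc p} p-prime (suc n) =
  subst₂ (λ x y → x ≡ y mod + (suc p ^ 4))
    (sym (cCoef-divisorSum (suc n * suc p))) (sym (cCoef-divisorSum (suc n)))
    (*-congˡ-mod (+ 3) (divisorSum-*-prime p-prime weight-divisible (suc n)))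

proposition7p12 : (p : ℕ) → Prime p → 5 ≤ p → (a m : ℕ) →
    (+ (p ^ 4)) ∣ ((C ⊛ pow (substQ p H) m) (a * p) - (C ⊛ pow H m) a)
proposition7p12 p p-prime _ a m =
  ∣⇒∣ᵤ (difference-divisible (subst (λ x → x ≡ (C ⊛ pow H m) a mod + (p ^ 4)) (sym substituted-power)
    (⊛-substQ-mod p (C[n*p]≡C[n] p-prime) (pow H m) a)))
  where
  instance
    p≢0 : NonZero p
    p≢0 = prime⇒nonZero p-prime
  substituted-power : (C ⊛ pow (substQ p H) m) (a * p) ≡ (C ⊛ substQ p (pow H m)) (a * p)
  substituted-power = ⊛-congʳ C (pow-substQ p H m) (a * p)
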